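{- Let $\lambda$ be a weakly decreasing partition of length $n$ and $\alpha=\lambda+\rho_n$. Then for every $\phi\in\Omega(\alpha)$, \[ P_{\phi(\lambda)}(x;t)=t^{\ell(\phi)}\,P_\lambda(x;t). \]
   Context: $\rho_n=(n-1,\ldots,1,0)$; tuples of equal length are added componentwise. $\Delta_n(t)=\prod_{1\le i<j\le n}(x_i-tx_j)$, $\Delta_n=\Delta_n(1)$. For a tuple $\kappa$ of integers of length $n$, $x^\kappa=x_1^{\kappa_1}\cdots x_n^{\kappa_n}$ and $P_\kappa(x;t)=\sum_{\sigma\in S_n}\sigma\bigl(x^\kappa\Delta_n(t)/\Delta_n\bigr)$, $\sigma$ permuting the variables. A raising operator is a product of operations $[i\;j]$ ($i\le j$) acting on finite tuples by $[i\;j](\lambda_1,\ldots,\lambda_n)=(\lambda_1,\ldots,\lambda_i-1,\ldots,\lambda_j+1,\ldots,\lambda_n)$; its length $\ell(\phi)$ is the number of factors in a minimal decomposition into elementary operators $[i\;i+1]$, and $\ell(\mathrm{Id})=0$. For a strictly decreasing tuple $\alpha$ of length $n$, $\Omega(\alpha)$ is the smallest set of raising operators containing $\mathrm{Id}$ such that whenever $\phi\in\Omega(\alpha)$ and $\phi(\alpha)=(\alpha'_1,\ldots,\alpha'_n)$ has $\alpha'_i=\alpha'_{i+1}+2$, then $[i\;i+1]\cdot\phi\in\Omega(\alpha)$. -}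

module Defs where

open import Data.Nat as ℕ using (ℕ; zero; suc; _∸_)
open import Data.Integer as ℤ using (ℤ; +_; -[1+_])
open import Data.Fin as Fin using (Fin; toℕ)
open import Data.Fin.Properties as FinP using ()
open import Data.Rational as ℚ using (ℚ; 0ℚ; 1ℚ; 1/_; _*_; _-_; ≢-nonZero)
open import Data.Rational.Properties as ℚP using ()
open import Data.List as List using (List; []; _∷_; length; foldr; allFin; filter; concatMap; map)
open import Data.List.Relation.Unary.All using (All)
open import Data.Vec as Vec using (Vec; lookup)
open import Data.Product using (Σ; _×_; _,_)
open import Data.Bool using (if_then_else_)
open import Relation.Nullary using (yes; no; does)
open import Relation.Binary.PropositionalEquality using (_≡_)
import Data.List.Relation.Unary.Unique.DecPropositional as UniqueDec

Tuple : ℕ → Set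
Tuple n = Fin n → ℤ

δ : ∀ {n} → Fin n → Fin n → ℤ
δ k i = if does (k FinP.≟ i) then + 1 else + 0

record Op (n : ℕ) : Set where
  constructor [_,_]⟨_⟩
  field
    i j : Fin n
    i≤j : i Fin.≤ j
open Op public

applyOp : ∀ {n} → Op n → Tuple n → Tuple n
applyOp o v k = (v k ℤ.- δ k (i o)) ℤ.+ δ k (j o)

-- a raising operator is a (finite) product of operations [i j];
-- the product o ∷ φ means o · φ (first φ, then o)
RaisingOp : ℕ → Set
RaisingOp n = List (Op n)

act : ∀ {n} → RaisingOp n → Tuple n → Tuple n
act []      v = v
act (o ∷ φ) v = applyOp o (act φ v)

SameOp : ∀ {n} → RaisingOp n → RaisingOp n → Set
SameOp {n} φ ψ = ∀ (v : Tuple n) k → act φ v k ≡ act ψ v k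

Elementary : ∀ {n} → Op n → Set
Elementary o = suc (toℕ (i o)) ≡ toℕ (j o)

IsLength : ∀ {n} → RaisingOp n → ℕ → Set
IsLength {n} φ k =
  (Σ (RaisingOp n) λ ψ → All Elementary ψ × length ψ ≡ k × SameOp φ ψ)
  × (∀ (ψ : RaisingOp n) → All Elementary ψ → SameOp φ ψ → k ℕ.≤ length ψ)

data Ω {n : ℕ} (α : Tuple n) : RaisingOp n → Set where
  Ω-id   : Ω α []
  Ω-step : ∀ {φ} (o : Op n) → Elementary o → Ω α φ →
           act φ α (i o) ≡ act φ α (j o) ℤ.+ + 2 → Ω α (o ∷ φ)

WeaklyDecreasing : ∀ {n} → (Fin n → ℕ) → Set
WeaklyDecreasing {n} λ' = ∀ (a b : Fin n) → a Fin.≤ b → λ' b ℕ.≤ λ' a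

ρ : (n : ℕ) → Fin n → ℕ
ρ n k = n ∸ suc (toℕ k)

toTuple : ∀ {n} → (Fin n → ℕ) → Tuple n
toTuple λ' k = + (λ' k)

-- total division (only used with nonzero denominators)
_÷'_ : ℚ → ℚ → ℚ
p ÷' q with q ℚP.≟ 0ℚ
... | yes _  = 0ℚ
... | no q≢0 = p * (1/_ q {{≢-nonZero q≢0}})

powℕ : ℚ → ℕ → ℚ
powℕ q zero    = 1ℚ
powℕ q (suc m) = q * powℕ q m

powℤ : ℚ → ℤ → ℚ
powℤ q (+ m)    = powℕ q m
powℤ q -[1+ m ] = 1ℚ ÷' powℕ q (suc m)

prodFin : ∀ n → (Fin n → ℚ) → ℚ
prodFin n f = foldr (λ a r → f a * r) 1ℚ (allFin n)

sumList : List ℚ → ℚ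
sumList = foldr ℚ._+_ 0ℚ

monomial : ∀ {n} → Tuple n → (Fin n → ℚ) → ℚ
monomial {n} κ y = prodFin n (λ a → powℤ (y a) (κ a))

Δt : ∀ n → (Fin n → ℚ) → ℚ → ℚ
Δt n y t = prodFin n λ a → prodFin n λ b →
  if does (a Fin.<? b) then y a - t * y b else 1ℚ

-- S_n, enumerated as the injective words of length n over Fin n
allWords : ∀ n m → List (Vec (Fin n) m)
allWords n zero    = Vec.[] ∷ []
allWords n (suc m) = concatMap (λ a → map (a Vec.∷_) (allWords n m)) (allFin n)

permutations : ∀ n → List (Fin n → Fin n)
permutations n =
  map lookup (filter (λ w → UniqueDec.unique? FinP._≟_ (Vec.toList w)) (allWords n n))

P : ∀ {n} → Tuple n → (Fin n → ℚ) → ℚ → ℚ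
P {n} κ x t = sumList (map term (permutations n))
  where
  term : (Fin n → Fin n) → ℚ
  term σ = let y = λ a → x (σ a) in
    (monomial κ y * Δt n y t) ÷' Δt n y 1ℚ

{-# OPTIONS --safe #-}

-- Along Ω(λ + ρ), write μ = φ(λ). The condition φ(α)_i = φ(α)_{i+1} + 2 together with
-- ρ_i = ρ_{i+1} + 1 says μ_i = μ_{i+1} + 1, so the next factor [i i+1] just exchanges
-- μ_i and μ_{i+1}. For such μ, write the S_n-summand as T_κ(y) = y^κ Δ_n(t)(y) / Δ_n(y).
-- Since y^μ = y_i Q and Δ_n(t)(y) = (y_i - t y_{i+1}) X with Q, X symmetric in y_i, y_{i+1},
-- the numerator of T_{s_i μ} - t T_μ is Q X (y_{i+1} - t y_i)(y_i - t y_{i+1}), which is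
-- symmetric, while Δ_n(y) is antisymmetric. So T_{s_i μ} - t T_μ changes sign under
-- y ↦ y ∘ s_i, its sum over S_n vanishes, and P_{s_i μ} = t P_μ.
-- For the length: every elementary operator raises Σ_k k v_k by exactly one, so all
-- decompositions of φ into elementary operators have the same length.
module Submission where

open import Defs
open import Data.Nat using (ℕ; _+_)
open import Data.Fin using (Fin)
open import Data.Rational using (ℚ; 0ℚ; _*_)
open import Data.Product using (Σ; _×_)
open import Relation.Binary.PropositionalEquality using (_≡_; _≢_)

open import Algebra.Bundles using (CommutativeMonoid; AbelianGroup)
open import Data.Bool using (true; false; if_then_else_)
open import Data.Empty using (⊥-elim)
open import Data.Fin as Fin using (zero; suc; toℕ)
import Data.Fin.Properties as FinP
open import Data.Integer as ℤ using (ℤ; +_)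
import Data.Integer.Properties as ℤP
import Data.Integer.Tactic.RingSolver as ℤ-Solver
open import Data.List as List using (List; []; _∷_; _++_; map; filter; concatMap; allFin; length)
import Data.List.Properties as ListP
open import Data.List.Relation.Unary.All using (All; []; _∷_)
import Data.List.Relation.Unary.Unique.DecPropositional as UniqueDec
open import Data.Maybe using (nothing)
open import Data.Nat using (zero; suc)
import Data.Nat.Properties as ℕP
open import Data.Product using (_,_; proj₂)
open import Data.Rational as ℚ using (1ℚ; _-_; -_; ½; 1/_)
import Data.Rational.Properties as ℚP
open import Data.Vec using (Vec; []; _∷_; lookup; toList)
open import Function using (_∘_; id; mk⇔)
open import Level using (0ℓ)
open import Relation.Binary.PropositionalEquality
  using (refl; sym; trans; cong; cong₂; _≗_; setoid; module ≡-Reasoning)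
open import Relation.Nullary.Decidable using (yes; no; does; does-⇔)
open import Relation.Unary using (Decidable)
open import Tactic.RingSolver using (solve-∀)
open import Tactic.RingSolver.Core.AlmostCommutativeRing
  using (AlmostCommutativeRing; fromCommutativeRing)

open import Algebra.Properties.CommutativeSemigroup
  (CommutativeMonoid.commutativeSemigroup ℚP.*-1-commutativeMonoid) using (x∙yz≈y∙xz)
open import Algebra.Properties.Group ℚP.+-0-group using (x∙y⁻¹≈ε⇒x≈y)
open import Algebra.Properties.Group (AbelianGroup.group ℤP.+-0-abelianGroup) using (∙-cancelʳ)
open import Algebra.Properties.Monoid.Sum ℚP.*-1-monoid
  using () renaming (sum to ∏; sum-cong-≗ to ∏-cong)
open import Algebra.Properties.Monoid.Sum ℤP.+-0-monoid
  using ()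
  renaming (sum to sumℤ; sum-cong-≗ to sumℤ-cong; sum-replicate-zero to sumℤ-replicate-zero)

private
  variable
    A B : Set
    n m : ℕ

ℚ-ring : AlmostCommutativeRing 0ℓ 0ℓ
ℚ-ring = fromCommutativeRing ℚP.+-*-commutativeRing (λ _ → nothing)

∑ : List A → (A → ℚ) → ℚ
∑ xs f = sumList (map f xs)

∑-cong : (xs : List A) {f g : A → ℚ} → f ≗ g → ∑ xs f ≡ ∑ xs g
∑-cong xs f≗g = cong sumList (ListP.map-cong f≗g xs)

∑-map : (xs : List A) (g : A → B) (f : B → ℚ) → ∑ (map g xs) f ≡ ∑ xs (f ∘ g)
∑-map xs g f = cong sumList (sym (ListP.map-∘ xs))

∑-++ : (xs ys : List A) (f : A → ℚ) → ∑ (xs ++ ys) f ≡ ∑ xs f ℚ.+ ∑ ys f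
∑-++ []       ys f = sym (ℚP.+-identityˡ _)
∑-++ (x ∷ xs) ys f = trans (cong (f x ℚ.+_) (∑-++ xs ys f)) (sym (ℚP.+-assoc (f x) _ _))

∑-concatMap : (xs : List A) (g : A → List B) (f : B → ℚ) →
              ∑ (concatMap g xs) f ≡ ∑ xs (λ a → ∑ (g a) f)
∑-concatMap []       g f = refl
∑-concatMap (x ∷ xs) g f =
  trans (∑-++ (g x) (concatMap g xs) f) (cong (∑ (g x) f ℚ.+_) (∑-concatMap xs g f))

∑-zero : (xs : List A) → ∑ xs (λ _ → 0ℚ) ≡ 0ℚ
∑-zero []       = refl
∑-zero (x ∷ xs) = cong (0ℚ ℚ.+_) (∑-zero xs)

∑-distrib-+ : (xs : List A) (f g : A → ℚ) → ∑ xs (λ a → f a ℚ.+ g a) ≡ ∑ xs f ℚ.+ ∑ xs g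
∑-distrib-+ []       f g = refl
∑-distrib-+ (x ∷ xs) f g =
  trans (cong (f x ℚ.+ g x ℚ.+_) (∑-distrib-+ xs f g)) (interchange (f x) (g x) _ _)
  where
  interchange : ∀ a b c d → (a ℚ.+ b) ℚ.+ (c ℚ.+ d) ≡ (a ℚ.+ c) ℚ.+ (b ℚ.+ d)
  interchange = solve-∀ ℚ-ring

∑-comm : (xs : List A) (ys : List B) (f : A → B → ℚ) →
         ∑ xs (λ a → ∑ ys (f a)) ≡ ∑ ys (λ b → ∑ xs (λ a → f a b))
∑-comm []       ys f = sym (∑-zero ys)
∑-comm (x ∷ xs) ys f =
  trans (cong (∑ ys (f x) ℚ.+_) (∑-comm xs ys f)) (sym (∑-distrib-+ ys (f x) _))

∑-filter : {P : A → Set} (P? : Decidable P) (xs : List A) (f : A → ℚ) →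
           ∑ (filter P? xs) f ≡ ∑ xs (λ a → if does (P? a) then f a else 0ℚ)
∑-filter P? []       f = refl
∑-filter P? (x ∷ xs) f with does (P? x)
... | true  = cong (f x ℚ.+_) (∑-filter P? xs f)
... | false = trans (∑-filter P? xs f) (sym (ℚP.+-identityˡ _))

∑-linear : (xs : List A) (f g : A → ℚ) (t : ℚ) →
           ∑ xs (λ a → f a - t * g a) ≡ ∑ xs f - t * ∑ xs g
∑-linear []       f g t = sym (cong (λ q → 0ℚ - q) (ℚP.*-zeroʳ t))
∑-linear (x ∷ xs) f g t =
  trans (cong (f x - t * g x ℚ.+_) (∑-linear xs f g t)) (regroup (f x) (g x) _ _ t)
  where
  regroup : ∀ a b c d t → (a - t * b) ℚ.+ (c - t * d) ≡ (a ℚ.+ c) - t * (b ℚ.+ d)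
  regroup = solve-∀ ℚ-ring

-- Adjacent transpositions

data Adjacent : ∀ {n} → Fin n → Fin n → Set where
  here  : Adjacent {suc (suc n)} zero (suc zero)
  there : ∀ {i j : Fin n} → Adjacent i j → Adjacent (suc i) (suc j)

elementary⇒adjacent : ∀ {i j : Fin n} → suc (toℕ i) ≡ toℕ j → Adjacent i j
elementary⇒adjacent {i = zero}  {j = suc zero}    _ = here
elementary⇒adjacent {i = suc i} {j = suc j}       e =
  there (elementary⇒adjacent (ℕP.suc-injective e))
elementary⇒adjacent {i = zero}  {j = zero}        ()
elementary⇒adjacent {i = zero}  {j = suc (suc j)} ()
elementary⇒adjacent {i = suc i} {j = zero}        ()

adjacent⇒≢ : ∀ {i j : Fin n} → Adjacent i j → i ≢ j
adjacent⇒≢ (there p) refl = adjacent⇒≢ p refl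

swap : ∀ {i j : Fin n} → Adjacent i j → Fin n → Fin n
swap here      zero          = suc zero
swap here      (suc zero)    = zero
swap here      (suc (suc k)) = suc (suc k)
swap (there p) zero          = zero
swap (there p) (suc k)       = suc (swap p k)

swap-involutive : ∀ {i j : Fin n} (p : Adjacent i j) (k : Fin n) → swap p (swap p k) ≡ k
swap-involutive here      zero          = refl
swap-involutive here      (suc zero)    = refl
swap-involutive here      (suc (suc k)) = refl
swap-involutive (there p) zero          = refl
swap-involutive (there p) (suc k)       = cong suc (swap-involutive p k)

swap-left : ∀ {i j : Fin n} (p : Adjacent i j) → swap p i ≡ j
swap-left here      = refl
swap-left (there p) = cong suc (swap-left p)

swap-right : ∀ {i j : Fin n} (p : Adjacent i j) → swap p j ≡ i
swap-right {i = i} p = trans (cong (swap p) (sym (swap-left p))) (swap-involutive p i)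

swap-fixed : ∀ {i j : Fin n} (p : Adjacent i j) {k : Fin n} → k ≢ i → k ≢ j → swap p k ≡ k
swap-fixed here      {zero}        k≢i k≢j = ⊥-elim (k≢i refl)
swap-fixed here      {suc zero}    k≢i k≢j = ⊥-elim (k≢j refl)
swap-fixed here      {suc (suc k)} k≢i k≢j = refl
swap-fixed (there p) {zero}        k≢i k≢j = refl
swap-fixed (there p) {suc k}       k≢i k≢j =
  cong suc (swap-fixed p (k≢i ∘ cong suc) (k≢j ∘ cong suc))

swapᵥ : ∀ {i j : Fin m} → Adjacent i j → Vec A m → Vec A m
swapᵥ here      (a ∷ b ∷ w) = b ∷ a ∷ w
swapᵥ (there p) (a ∷ w)     = a ∷ swapᵥ p w

lookup-swapᵥ : ∀ {i j : Fin m} (p : Adjacent i j) (w : Vec A m) (k : Fin m) →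
               lookup (swapᵥ p w) k ≡ lookup w (swap p k)
lookup-swapᵥ here      (a ∷ b ∷ w) zero          = refl
lookup-swapᵥ here      (a ∷ b ∷ w) (suc zero)    = refl
lookup-swapᵥ here      (a ∷ b ∷ w) (suc (suc k)) = refl
lookup-swapᵥ (there p) (a ∷ w)     zero          = refl
lookup-swapᵥ (there p) (a ∷ w)     (suc k)       = lookup-swapᵥ p w k

module _ {n : ℕ} where

  open import Data.List.Relation.Binary.Permutation.Setoid (setoid (Fin n))
    using (_↭_; ↭-refl; ↭-prep; ↭-swap; ↭-sym)
  open import Data.List.Relation.Binary.Permutation.Setoid.Properties (setoid (Fin n))
    using (Unique-resp-↭)

  toList-swapᵥ-↭ : ∀ {i j : Fin m} (p : Adjacent i j) (w : Vec (Fin n) m) →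
                   toList (swapᵥ p w) ↭ toList w
  toList-swapᵥ-↭ here      (a ∷ b ∷ w) = ↭-swap b a ↭-refl
  toList-swapᵥ-↭ (there p) (a ∷ w)     = ↭-prep a (toList-swapᵥ-↭ p w)

  does-unique?-swapᵥ : ∀ {i j : Fin m} (p : Adjacent i j) (w : Vec (Fin n) m) →
    does (UniqueDec.unique? FinP._≟_ (toList (swapᵥ p w))) ≡
    does (UniqueDec.unique? FinP._≟_ (toList w))
  does-unique?-swapᵥ p w = does-⇔
    (mk⇔ (Unique-resp-↭ (toList-swapᵥ-↭ p w))
          (Unique-resp-↭ (↭-sym (toList-swapᵥ-↭ p w))))
    (UniqueDec.unique? FinP._≟_ _) (UniqueDec.unique? FinP._≟_ _)

-- Sums over S_n

∑-allWords-suc : (f : Vec (Fin n) (suc m) → ℚ) →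
  ∑ (allWords n (suc m)) f ≡ ∑ (allFin n) (λ a → ∑ (allWords n m) (f ∘ (a ∷_)))
∑-allWords-suc {n} {m} f = trans (∑-concatMap (allFin n) _ f)
  (∑-cong (allFin n) (λ a → ∑-map (allWords n m) (a ∷_) f))

∑-allWords-swapᵥ : ∀ {i j : Fin m} (p : Adjacent i j) (f : Vec (Fin n) m → ℚ) →
                   ∑ (allWords n m) (f ∘ swapᵥ p) ≡ ∑ (allWords n m) f
∑-allWords-swapᵥ {m = suc (suc m)} {n = n} here f = begin
  ∑ (allWords n (suc (suc m))) (f ∘ swapᵥ here)
    ≡⟨ ∑-allWords-suc (f ∘ swapᵥ here) ⟩
  _ ≡⟨ ∑-cong (allFin n) (λ a → ∑-allWords-suc (λ w → f (swapᵥ here (a ∷ w)))) ⟩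
  ∑ (allFin n) (λ a → ∑ (allFin n) (λ b → ∑ (allWords n m) (λ w → f (b ∷ a ∷ w))))
    ≡⟨ ∑-comm (allFin n) (allFin n) _ ⟩
  ∑ (allFin n) (λ b → ∑ (allFin n) (λ a → ∑ (allWords n m) (λ w → f (b ∷ a ∷ w))))
    ≡⟨ ∑-cong (allFin n) (λ b → ∑-allWords-suc (λ w → f (b ∷ w))) ⟨
  _ ≡⟨ ∑-allWords-suc f ⟨
  ∑ (allWords n (suc (suc m))) f ∎
  where open ≡-Reasoning
∑-allWords-swapᵥ {m = suc m} {n = n} (there p) f = begin
  ∑ (allWords n (suc m)) (f ∘ swapᵥ (there p))
    ≡⟨ ∑-allWords-suc (f ∘ swapᵥ (there p)) ⟩
  _ ≡⟨ ∑-cong (allFin n) (λ a → ∑-allWords-swapᵥ p (f ∘ (a ∷_))) ⟩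
  _ ≡⟨ ∑-allWords-suc f ⟨
  ∑ (allWords n (suc m)) f ∎
  where open ≡-Reasoning

x+x≡0⇒x≡0 : ∀ x → x ℚ.+ x ≡ 0ℚ → x ≡ 0ℚ
x+x≡0⇒x≡0 x x+x≡0 = begin
  x              ≡⟨ halve x ⟩
  ½ * (x ℚ.+ x)  ≡⟨ cong (½ *_) x+x≡0 ⟩
  ½ * 0ℚ         ≡⟨ ℚP.*-zeroʳ ½ ⟩
  0ℚ             ∎
  where
  open ≡-Reasoning
  halve : ∀ x → x ≡ ½ * (x ℚ.+ x)
  halve = solve-∀ ℚ-ring

-- permutations n is the list of injective words; swapping two letters permutes all words
-- and preserves injectivity.
∑-permutations-antisymmetric : ∀ {i j : Fin n} (p : Adjacent i j) (f : (Fin n → Fin n) → ℚ) →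
  (∀ σ τ → τ ≗ σ ∘ swap p → f τ ≡ - f σ) → ∑ (permutations n) f ≡ 0ℚ
∑-permutations-antisymmetric {n} p f f-antisymmetric = x+x≡0⇒x≡0 _ (begin
  ∑ (permutations n) f ℚ.+ ∑ (permutations n) f
    ≡⟨ cong₂ ℚ._+_ (trans ∑-permutations (sym (∑-allWords-swapᵥ p F))) ∑-permutations ⟩
  ∑ Words (F ∘ swapᵥ p) ℚ.+ ∑ Words F
    ≡⟨ ∑-distrib-+ Words (F ∘ swapᵥ p) F ⟨
  ∑ Words (λ w → F (swapᵥ p w) ℚ.+ F w)
    ≡⟨ ∑-cong Words cancel ⟩
  ∑ Words (λ _ → 0ℚ)
    ≡⟨ ∑-zero Words ⟩
  0ℚ ∎)
  where
  open ≡-Reasoning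
  Words = allWords n n
  Unique? = λ (w : Vec (Fin n) n) → UniqueDec.unique? FinP._≟_ (toList w)

  F : Vec (Fin n) n → ℚ
  F w = if does (Unique? w) then f (lookup w) else 0ℚ

  ∑-permutations : ∑ (permutations n) f ≡ ∑ Words F
  ∑-permutations = trans (∑-map (filter Unique? Words) lookup f) (∑-filter Unique? Words _)

  cancel : ∀ w → F (swapᵥ p w) ℚ.+ F w ≡ 0ℚ
  cancel w with does (Unique? (swapᵥ p w)) | does (Unique? w) | does-unique?-swapᵥ p w
  ... | true  | true  | refl =
    trans (cong (ℚ._+ f (lookup w)) (f-antisymmetric _ _ (lookup-swapᵥ p w)))
          (ℚP.+-inverseˡ (f (lookup w)))
  ... | false | false | refl = refl

foldr-*-tabulate : (g : A → ℚ) (h : Fin n → A) →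
                   List.foldr (λ a r → g a * r) 1ℚ (List.tabulate h) ≡ ∏ (g ∘ h)
foldr-*-tabulate {n = zero}  g h = refl
foldr-*-tabulate {n = suc n} g h = cong (g (h zero) *_) (foldr-*-tabulate g (h ∘ suc))

prodFin≡∏ : (f : Fin n → ℚ) → prodFin n f ≡ ∏ f
prodFin≡∏ f = foldr-*-tabulate f id

∏-swap : ∀ {i j : Fin n} (p : Adjacent i j) (f : Fin n → ℚ) → ∏ (f ∘ swap p) ≡ ∏ f
∏-swap here      f = x∙yz≈y∙xz (f (suc zero)) (f zero) _
∏-swap (there p) f = cong (f zero *_) (∏-swap p (f ∘ suc))

-- monomial and Δt of Defs, with a product over Fin that unfolds definitionally on suc.
monomial′ : Tuple n → (Fin n → ℚ) → ℚ
monomial′ κ y = ∏ (λ a → powℤ (y a) (κ a))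

Δ′ : (Fin n → ℚ) → ℚ → ℚ
Δ′ y t = ∏ (λ a → ∏ (λ b → if does (a Fin.<? b) then y a - t * y b else 1ℚ))

summand : Tuple n → ℚ → (Fin n → ℚ) → ℚ
summand κ t y = (monomial′ κ y * Δ′ y t) ÷' Δ′ y 1ℚ

monomial≡monomial′ : (κ : Tuple n) (y : Fin n → ℚ) → monomial κ y ≡ monomial′ κ y
monomial≡monomial′ κ y = prodFin≡∏ (λ a → powℤ (y a) (κ a))

Δt≡Δ′ : (y : Fin n → ℚ) (t : ℚ) → Δt n y t ≡ Δ′ y t
Δt≡Δ′ {n} y t =
  trans (prodFin≡∏ (λ a → prodFin n (entry a))) (∏-cong (λ a → prodFin≡∏ (entry a)))
  where
  entry : Fin n → Fin n → ℚ
  entry a b = if does (a Fin.<? b) then y a - t * y b else 1ℚ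

P≡∑summand : (κ : Tuple n) (x : Fin n → ℚ) (t : ℚ) →
             P κ x t ≡ ∑ (permutations n) (λ σ → summand κ t (x ∘ σ))
P≡∑summand {n} κ x t = ∑-cong (permutations n) λ σ →
  cong₂ _÷'_ (cong₂ _*_ (monomial≡monomial′ κ (x ∘ σ)) (Δt≡Δ′ (x ∘ σ) t))
             (Δt≡Δ′ (x ∘ σ) 1ℚ)

monomial′-cong : (κ : Tuple n) {y y′ : Fin n → ℚ} → y ≗ y′ → monomial′ κ y ≡ monomial′ κ y′
monomial′-cong κ y≗y′ = ∏-cong (λ a → cong (λ q → powℤ q (κ a)) (y≗y′ a))

Δ′-cong : {y y′ : Fin n → ℚ} (t : ℚ) → y ≗ y′ → Δ′ y t ≡ Δ′ y′ t
Δ′-cong t y≗y′ = ∏-cong λ a → ∏-cong λ b →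
  cong₂ (λ u v → if does (a Fin.<? b) then u - t * v else 1ℚ) (y≗y′ a) (y≗y′ b)

summand-cong : (κ : Tuple n) (t : ℚ) {y y′ : Fin n → ℚ} → y ≗ y′ →
               summand κ t y ≡ summand κ t y′
summand-cong κ t y≗y′ =
  cong₂ _÷'_ (cong₂ _*_ (monomial′-cong κ y≗y′) (Δ′-cong t y≗y′)) (Δ′-cong 1ℚ y≗y′)

monomial′-swap : ∀ {i j : Fin n} (p : Adjacent i j) {κ κ′ : Tuple n} → κ′ ≗ κ ∘ swap p →
                 (y : Fin n → ℚ) → monomial′ κ′ (y ∘ swap p) ≡ monomial′ κ y
monomial′-swap p {κ} κ′≗κ∘swap y = trans
  (∏-cong (λ a → cong (powℤ (y (swap p a))) (κ′≗κ∘swap a)))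
  (∏-swap p (λ a → powℤ (y a) (κ a)))

monomial′-factor : ∀ {i j : Fin n} (p : Adjacent i j) {κ : Tuple n} {c : ℕ} →
  κ i ≡ + suc c → κ j ≡ + c → (y : Fin n → ℚ) →
  Σ ℚ λ Q → monomial′ κ y ≡ y i * Q × monomial′ κ (y ∘ swap p) ≡ y j * Q
monomial′-factor here {κ} {c} κ₀ κ₁ y =
  powℕ y₀ c * (powℕ y₁ c * R) ,
  trans (cong₂ (λ u v → powℤ y₀ u * (powℤ y₁ v * R)) κ₀ κ₁) (ℚP.*-assoc y₀ _ _) ,
  trans (cong₂ (λ u v → powℤ y₁ u * (powℤ y₀ v * R)) κ₀ κ₁)
        (trans (ℚP.*-assoc y₁ _ _)
               (cong (y₁ *_) (x∙yz≈y∙xz (powℕ y₁ c) (powℕ y₀ c) R)))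
  where
  y₀ = y zero
  y₁ = y (suc zero)
  R = ∏ (λ a → powℤ (y (suc (suc a))) (κ (suc (suc a))))
monomial′-factor {i = suc i} {suc j} (there p) {κ} κᵢ κⱼ y
  with monomial′-factor p κᵢ κⱼ (y ∘ suc)
... | Q , factorᵢ , factorⱼ =
  y₀ᵏ * Q ,
  trans (cong (y₀ᵏ *_) factorᵢ) (x∙yz≈y∙xz y₀ᵏ (y (suc i)) Q) ,
  trans (cong (y₀ᵏ *_) factorⱼ) (x∙yz≈y∙xz y₀ᵏ (y (suc j)) Q)
  where y₀ᵏ = powℤ (y zero) (κ zero)

Δ′-suc : (y : Fin (suc n) → ℚ) (t : ℚ) →
         Δ′ y t ≡ ∏ (λ b → y zero - t * y (suc b)) * Δ′ (y ∘ suc) t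
Δ′-suc {n} y t = cong₂ _*_ (ℚP.*-identityˡ (∏ (λ b → y zero - t * y (suc b))))
                        (∏-cong (λ a → ℚP.*-identityˡ (∏ (entry (suc a) ∘ suc))))
  where
  entry : Fin (suc n) → Fin (suc n) → ℚ
  entry a b = if does (a Fin.<? b) then y a - t * y b else 1ℚ

Δ′-factor : ∀ {i j : Fin n} (p : Adjacent i j) (y : Fin n → ℚ) (t : ℚ) →
  Σ ℚ λ X → Δ′ y t ≡ (y i - t * y j) * X × Δ′ (y ∘ swap p) t ≡ (y j - t * y i) * X
Δ′-factor {suc (suc n)} here y t =
  E₀ * (E₁ * D) ,
  trans (unfold y) (ℚP.*-assoc (y₀ - t * y₁) E₀ (E₁ * D)) ,
  trans (unfold (y ∘ swap here))
        (trans (ℚP.*-assoc (y₁ - t * y₀) E₁ (E₀ * D))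
               (cong ((y₁ - t * y₀) *_) (x∙yz≈y∙xz E₁ E₀ D)))
  where
  y₀ y₁ E₀ E₁ D : ℚ
  y₀ = y zero
  y₁ = y (suc zero)
  E₀ = ∏ (λ b → y₀ - t * y (suc (suc b)))
  E₁ = ∏ (λ b → y₁ - t * y (suc (suc b)))
  D = Δ′ (λ b → y (suc (suc b))) t
  unfold : (y : Fin (suc (suc n)) → ℚ) → Δ′ y t ≡
    ∏ (λ b → y zero - t * y (suc b)) *
    (∏ (λ b → y (suc zero) - t * y (suc (suc b))) * Δ′ (λ b → y (suc (suc b))) t)
  unfold y =
    trans (Δ′-suc y t) (cong (∏ (λ b → y zero - t * y (suc b)) *_) (Δ′-suc (y ∘ suc) t))
Δ′-factor {i = suc i} {suc j} (there p) y t with Δ′-factor p (y ∘ suc) t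
... | X , factor , factor-swapped =
  E * X ,
  trans (Δ′-suc y t)
        (trans (cong (E *_) factor) (x∙yz≈y∙xz E (y (suc i) - t * y (suc j)) X)) ,
  trans (Δ′-suc (y ∘ swap (there p)) t)
        (trans (cong₂ _*_ (∏-swap p (λ b → y zero - t * y (suc b))) factor-swapped)
               (x∙yz≈y∙xz E (y (suc j) - t * y (suc i)) X))
  where E = ∏ (λ b → y zero - t * y (suc b))

neg-distrib-1/ : ∀ q .{{_ : ℚ.NonZero q}} .{{_ : ℚ.NonZero (- q)}} → 1/ (- q) ≡ - (1/ q)
neg-distrib-1/ (ℚ.mkℚ ℤ.+[1+ _ ] _ _) = refl
neg-distrib-1/ (ℚ.mkℚ ℤ.-[1+ _ ] _ _) = refl

-- ÷' is total (p ÷' 0 = 0), so these hold without side conditions.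
neg-distribʳ-÷' : ∀ p q → p ÷' (- q) ≡ - (p ÷' q)
neg-distribʳ-÷' p q with q ℚP.≟ 0ℚ | (- q) ℚP.≟ 0ℚ
... | yes _    | yes _     = refl
... | yes q≡0  | no -q≢0   = ⊥-elim (-q≢0 (cong -_ q≡0))
... | no q≢0   | yes -q≡0  = ⊥-elim (q≢0 (ℚP.neg-injective -q≡0))
... | no q≢0   | no -q≢0   = trans
  (cong (p *_) (neg-distrib-1/ q {{ℚ.≢-nonZero q≢0}} {{ℚ.≢-nonZero -q≢0}}))
  (sym (ℚP.neg-distribʳ-* p _))

÷'-linear : ∀ p q r t → (p - t * q) ÷' r ≡ p ÷' r - t * (q ÷' r)
÷'-linear p q r t with r ℚP.≟ 0ℚ
... | yes _ = sym (cong (λ u → 0ℚ - u) (ℚP.*-zeroʳ t))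
... | no _  = distrib p q t _
  where
  distrib : ∀ p q t r⁻¹ → (p - t * q) * r⁻¹ ≡ p * r⁻¹ - t * (q * r⁻¹)
  distrib = solve-∀ ℚ-ring

-- Straightening an adjacent pair

summand-difference : Tuple n → Tuple n → ℚ → (Fin n → ℚ) → ℚ
summand-difference κ′ κ t y = summand κ′ t y - t * summand κ t y

summand-difference-cong : (κ′ κ : Tuple n) (t : ℚ) {y y′ : Fin n → ℚ} → y ≗ y′ →
                          summand-difference κ′ κ t y ≡ summand-difference κ′ κ t y′
summand-difference-cong κ′ κ t y≗y′ =
  cong₂ (λ u v → u - t * v) (summand-cong κ′ t y≗y′) (summand-cong κ t y≗y′)

Δ′-antisymmetric : ∀ {i j : Fin n} (p : Adjacent i j) (y : Fin n → ℚ) →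
                   Δ′ (y ∘ swap p) 1ℚ ≡ - Δ′ y 1ℚ
Δ′-antisymmetric {i = i} {j} p y with Δ′-factor p y 1ℚ
... | Z , factor , factor-swapped = begin
  Δ′ (y ∘ swap p) 1ℚ           ≡⟨ factor-swapped ⟩
  (y j - 1ℚ * y i) * Z         ≡⟨ flip (y i) (y j) Z ⟩
  - ((y i - 1ℚ * y j) * Z)     ≡⟨ cong -_ factor ⟨
  - Δ′ y 1ℚ                    ∎
  where
  open ≡-Reasoning
  flip : ∀ a b Z → (b - 1ℚ * a) * Z ≡ - ((a - 1ℚ * b) * Z)
  flip = solve-∀ ℚ-ring

difference-numerator : Tuple n → Tuple n → ℚ → (Fin n → ℚ) → ℚ
difference-numerator κ′ κ t y = monomial′ κ′ y * Δ′ y t - t * (monomial′ κ y * Δ′ y t)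

summand-difference≡numerator÷Δ′ : (κ′ κ : Tuple n) (t : ℚ) (y : Fin n → ℚ) →
  summand-difference κ′ κ t y ≡ difference-numerator κ′ κ t y ÷' Δ′ y 1ℚ
summand-difference≡numerator÷Δ′ κ′ κ t y =
  sym (÷'-linear (monomial′ κ′ y * Δ′ y t) (monomial′ κ y * Δ′ y t) (Δ′ y 1ℚ) t)

difference-numerator-symmetric : ∀ {i j : Fin n} (p : Adjacent i j) {κ κ′ : Tuple n} {c : ℕ} →
  κ′ ≗ κ ∘ swap p → κ i ≡ + suc c → κ j ≡ + c → (t : ℚ) (y : Fin n → ℚ) →
  difference-numerator κ′ κ t (y ∘ swap p) ≡ difference-numerator κ′ κ t y
difference-numerator-symmetric {i = i} {j} p {κ} {κ′} κ′≗κ∘swap κᵢ κⱼ t y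
  with monomial′-factor p κᵢ κⱼ y | Δ′-factor p y t
... | Q , monomialᵢ , monomialⱼ | X , Δ-factor , Δ-swapped = begin
  difference-numerator κ′ κ t (y ∘ swap p)
    ≡⟨ cong₂ (λ u v → u * Δ′ (y ∘ swap p) t - t * (v * Δ′ (y ∘ swap p) t))
             (trans (monomial′-swap p {κ} κ′≗κ∘swap y) monomialᵢ) monomialⱼ ⟩
  y i * Q * Δ′ (y ∘ swap p) t - t * (y j * Q * Δ′ (y ∘ swap p) t)
    ≡⟨ cong (λ d → y i * Q * d - t * (y j * Q * d)) Δ-swapped ⟩
  y i * Q * ((y j - t * y i) * X) - t * (y j * Q * ((y j - t * y i) * X))
    ≡⟨ exchange (y i) (y j) t Q X ⟩
  y j * Q * ((y i - t * y j) * X) - t * (y i * Q * ((y i - t * y j) * X))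
    ≡⟨ cong (λ d → y j * Q * d - t * (y i * Q * d)) Δ-factor ⟨
  y j * Q * Δ′ y t - t * (y i * Q * Δ′ y t)
    ≡⟨ cong₂ (λ u v → u * Δ′ y t - t * (v * Δ′ y t)) monomial′-κ′ monomialᵢ ⟨
  difference-numerator κ′ κ t y ∎
  where
  open ≡-Reasoning

  monomial′-κ′ : monomial′ κ′ y ≡ y j * Q
  monomial′-κ′ = begin
    monomial′ κ′ y                       ≡⟨ monomial′-cong κ′ (cong y ∘ swap-involutive p) ⟨
    monomial′ κ′ (y ∘ swap p ∘ swap p)   ≡⟨ monomial′-swap p {κ} κ′≗κ∘swap (y ∘ swap p) ⟩
    monomial′ κ (y ∘ swap p)             ≡⟨ monomialⱼ ⟩
    y j * Q                              ∎

  exchange : ∀ a b t Q X →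
    a * Q * ((b - t * a) * X) - t * (b * Q * ((b - t * a) * X)) ≡
    b * Q * ((a - t * b) * X) - t * (a * Q * ((a - t * b) * X))
  exchange = solve-∀ ℚ-ring

summand-difference-antisymmetric : ∀ {i j : Fin n} (p : Adjacent i j) {κ κ′ : Tuple n} {c : ℕ} →
  κ′ ≗ κ ∘ swap p → κ i ≡ + suc c → κ j ≡ + c → (t : ℚ) (y : Fin n → ℚ) →
  summand-difference κ′ κ t (y ∘ swap p) ≡ - summand-difference κ′ κ t y
summand-difference-antisymmetric p {κ} {κ′} κ′≗κ∘swap κᵢ κⱼ t y = begin
  summand-difference κ′ κ t (y ∘ swap p)
    ≡⟨ summand-difference≡numerator÷Δ′ κ′ κ t (y ∘ swap p) ⟩
  N (y ∘ swap p) ÷' Δ′ (y ∘ swap p) 1ℚ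
    ≡⟨ cong₂ _÷'_ (difference-numerator-symmetric p κ′≗κ∘swap κᵢ κⱼ t y) (Δ′-antisymmetric p y) ⟩
  N y ÷' (- Δ′ y 1ℚ)
    ≡⟨ neg-distribʳ-÷' (N y) (Δ′ y 1ℚ) ⟩
  - (N y ÷' Δ′ y 1ℚ)
    ≡⟨ cong -_ (summand-difference≡numerator÷Δ′ κ′ κ t y) ⟨
  - summand-difference κ′ κ t y ∎
  where
  open ≡-Reasoning
  N = difference-numerator κ′ κ t

P-swap : ∀ {i j : Fin n} (p : Adjacent i j) {κ κ′ : Tuple n} {c : ℕ} → κ′ ≗ κ ∘ swap p →
         κ i ≡ + suc c → κ j ≡ + c → (x : Fin n → ℚ) (t : ℚ) → P κ′ x t ≡ t * P κ x t
P-swap {n} p {κ} {κ′} κ′≗κ∘swap κᵢ κⱼ x t = x∙y⁻¹≈ε⇒x≈y _ _ (begin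
  P κ′ x t - t * P κ x t
    ≡⟨ cong₂ (λ u v → u - t * v) (P≡∑summand κ′ x t) (P≡∑summand κ x t) ⟩
  ∑ Sₙ (λ σ → summand κ′ t (x ∘ σ)) - t * ∑ Sₙ (λ σ → summand κ t (x ∘ σ))
    ≡⟨ ∑-linear Sₙ _ _ t ⟨
  ∑ Sₙ (λ σ → summand-difference κ′ κ t (x ∘ σ))
    ≡⟨ ∑-permutations-antisymmetric p _ antisymmetric ⟩
  0ℚ ∎)
  where
  open ≡-Reasoning
  Sₙ = permutations n
  antisymmetric : ∀ σ τ → τ ≗ σ ∘ swap p →
    summand-difference κ′ κ t (x ∘ τ) ≡ - summand-difference κ′ κ t (x ∘ σ)
  antisymmetric σ τ τ≗σ∘swap = trans
    (summand-difference-cong κ′ κ t (cong x ∘ τ≗σ∘swap))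
    (summand-difference-antisymmetric p κ′≗κ∘swap κᵢ κⱼ t (x ∘ σ))

-- Raising operators and their length

act-+ : (φ : RaisingOp n) (v w : Tuple n) (k : Fin n) →
        act φ (λ a → v a ℤ.+ w a) k ≡ act φ v k ℤ.+ w k
act-+ []      v w k = refl
act-+ (o ∷ φ) v w k =
  trans (cong (λ u → (u ℤ.- δ k (i o)) ℤ.+ δ k (j o)) (act-+ φ v w k))
        (shift (act φ v k) (w k) (δ k (i o)) (δ k (j o)))
  where
  shift : ∀ a b d e → ((a ℤ.+ b) ℤ.- d) ℤ.+ e ≡ ((a ℤ.- d) ℤ.+ e) ℤ.+ b
  shift = ℤ-Solver.solve-∀

applyOp-adjacent : (o : Op n) (p : Adjacent (i o) (j o)) {μ : Tuple n} →
                   μ (i o) ≡ ℤ.suc (μ (j o)) → applyOp o μ ≗ μ ∘ swap p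
applyOp-adjacent o p {μ} μᵢ k with k FinP.≟ i o | k FinP.≟ j o
... | yes refl | yes k≡j = ⊥-elim (adjacent⇒≢ p k≡j)
... | yes refl | no _    =
  trans (cong (λ u → (u ℤ.- + 1) ℤ.+ + 0) μᵢ)
        (trans (pred-suc (μ (j o))) (cong μ (sym (swap-left p))))
  where
  pred-suc : ∀ a → ((+ 1 ℤ.+ a) ℤ.- + 1) ℤ.+ + 0 ≡ a
  pred-suc = ℤ-Solver.solve-∀
... | no _     | yes refl =
  trans (suc-form (μ (j o))) (trans (sym μᵢ) (cong μ (sym (swap-right p))))
  where
  suc-form : ∀ a → (a ℤ.- + 0) ℤ.+ + 1 ≡ + 1 ℤ.+ a
  suc-form = ℤ-Solver.solve-∀
... | no k≢i   | no k≢j   = trans (unchanged (μ k)) (cong μ (sym (swap-fixed p k≢i k≢j)))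
  where
  unchanged : ∀ a → (a ℤ.- + 0) ℤ.+ + 0 ≡ a
  unchanged = ℤ-Solver.solve-∀

ρ-adjacent : ∀ {i j : Fin n} → Adjacent i j → ρ n i ≡ suc (ρ n j)
ρ-adjacent here      = refl
ρ-adjacent (there p) = ρ-adjacent p

Ω-descent : (lam : Fin n → ℕ) (φ : RaisingOp n) (o : Op n) (p : Adjacent (i o) (j o)) →
  let α = toTuple (λ a → lam a + ρ n a) in
  act φ α (i o) ≡ act φ α (j o) ℤ.+ + 2 →
  act φ (toTuple lam) (i o) ≡ ℤ.suc (act φ (toTuple lam) (j o))
Ω-descent {n} lam φ o p gap = ∙-cancelʳ (+ ρ n (i o)) _ _ (begin
  μ (i o) ℤ.+ + ρ n (i o)
    ≡⟨ act-+ φ (toTuple lam) (toTuple (ρ n)) (i o) ⟨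
  act φ α (i o)
    ≡⟨ gap ⟩
  act φ α (j o) ℤ.+ + 2
    ≡⟨ cong (ℤ._+ + 2) (act-+ φ (toTuple lam) (toTuple (ρ n)) (j o)) ⟩
  (μ (j o) ℤ.+ + ρ n (j o)) ℤ.+ + 2
    ≡⟨ regroup (μ (j o)) (+ ρ n (j o)) ⟩
  ℤ.suc (μ (j o)) ℤ.+ + suc (ρ n (j o))
    ≡⟨ cong (λ r → ℤ.suc (μ (j o)) ℤ.+ + r) (ρ-adjacent p) ⟨
  ℤ.suc (μ (j o)) ℤ.+ + ρ n (i o) ∎)
  where
  open ≡-Reasoning
  α = toTuple (λ a → lam a + ρ n a)
  μ = act φ (toTuple lam)
  regroup : ∀ a r → (a ℤ.+ r) ℤ.+ + 2 ≡ (+ 1 ℤ.+ a) ℤ.+ (+ 1 ℤ.+ r)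
  regroup = ℤ-Solver.solve-∀

weight : Tuple n → ℤ
weight v = sumℤ (λ k → + toℕ k ℤ.* v k)

sumℤ-*-zero : (c : Fin n → ℤ) → sumℤ (λ k → c k ℤ.* + 0) ≡ + 0
sumℤ-*-zero {n} c = trans (sumℤ-cong (λ k → ℤP.*-zeroʳ (c k))) (sumℤ-replicate-zero n)

sumℤ-*-δ : (c : Fin n → ℤ) (i : Fin n) → sumℤ (λ k → c k ℤ.* δ k i) ≡ c i
sumℤ-*-δ c zero    = trans (cong₂ ℤ._+_ (ℤP.*-identityʳ (c zero)) (sumℤ-*-zero (c ∘ suc)))
                           (ℤP.+-identityʳ (c zero))
sumℤ-*-δ c (suc i) = trans (cong₂ ℤ._+_ (ℤP.*-zeroʳ (c zero)) (sumℤ-*-δ (c ∘ suc) i))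
                           (ℤP.+-identityˡ (c (suc i)))

sumℤ-linear : (f g h : Fin n → ℤ) →
              sumℤ (λ k → (f k ℤ.- g k) ℤ.+ h k) ≡ (sumℤ f ℤ.- sumℤ g) ℤ.+ sumℤ h
sumℤ-linear {zero}  f g h = refl
sumℤ-linear {suc n} f g h =
  trans (cong (ℤ._+_ ((f zero ℤ.- g zero) ℤ.+ h zero))
              (sumℤ-linear (f ∘ suc) (g ∘ suc) (h ∘ suc)))
        (regroup (f zero) (g zero) (h zero) (sumℤ (f ∘ suc)) (sumℤ (g ∘ suc)) (sumℤ (h ∘ suc)))
  where
  regroup : ∀ a b c A B C →
    ((a ℤ.- b) ℤ.+ c) ℤ.+ ((A ℤ.- B) ℤ.+ C) ≡ ((a ℤ.+ A) ℤ.- (b ℤ.+ B)) ℤ.+ (c ℤ.+ C)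
  regroup = ℤ-Solver.solve-∀

weight-applyOp : (o : Op n) → Elementary o → (v : Tuple n) →
                 weight (applyOp o v) ≡ ℤ.suc (weight v)
weight-applyOp {n} o elementary v = begin
  weight (applyOp o v)
    ≡⟨ sumℤ-cong (λ k → distrib (c k) (v k) (δ k (i o)) (δ k (j o))) ⟩
  sumℤ (λ k → (c k ℤ.* v k ℤ.- c k ℤ.* δ k (i o)) ℤ.+ c k ℤ.* δ k (j o))
    ≡⟨ sumℤ-linear (λ k → c k ℤ.* v k) (λ k → c k ℤ.* δ k (i o)) (λ k → c k ℤ.* δ k (j o)) ⟩
  (weight v ℤ.- sumℤ (λ k → c k ℤ.* δ k (i o))) ℤ.+ sumℤ (λ k → c k ℤ.* δ k (j o))
    ≡⟨ cong₂ (λ a b → (weight v ℤ.- a) ℤ.+ b) (sumℤ-*-δ c (i o)) (sumℤ-*-δ c (j o)) ⟩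
  (weight v ℤ.- c (i o)) ℤ.+ + toℕ (j o)
    ≡⟨ cong (λ m → (weight v ℤ.- c (i o)) ℤ.+ + m) elementary ⟨
  (weight v ℤ.- c (i o)) ℤ.+ (+ 1 ℤ.+ c (i o))
    ≡⟨ cancel (weight v) (c (i o)) ⟩
  + 1 ℤ.+ weight v ∎
  where
  open ≡-Reasoning
  c : Fin n → ℤ
  c k = + toℕ k
  distrib : ∀ a x d e → a ℤ.* ((x ℤ.- d) ℤ.+ e) ≡ (a ℤ.* x ℤ.- a ℤ.* d) ℤ.+ a ℤ.* e
  distrib = ℤ-Solver.solve-∀
  cancel : ∀ w m → (w ℤ.- m) ℤ.+ (+ 1 ℤ.+ m) ≡ + 1 ℤ.+ w
  cancel = ℤ-Solver.solve-∀

weight-act-elementary : (ψ : RaisingOp n) → All Elementary ψ →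
                        weight (act ψ (λ _ → + 0)) ≡ + length ψ
weight-act-elementary {n} []      []         = sumℤ-*-zero {n} (λ k → + toℕ k)
weight-act-elementary     (o ∷ ψ) (el ∷ els) =
  trans (weight-applyOp o el (act ψ (λ _ → + 0))) (cong ℤ.suc (weight-act-elementary ψ els))

elementary-IsLength : (φ : RaisingOp n) → All Elementary φ → IsLength φ (length φ)
elementary-IsLength φ φ-elementary =
  (φ , φ-elementary , refl , λ _ _ → refl) ,
  λ ψ ψ-elementary φ≈ψ → ℕP.≤-reflexive (ℤP.+-injective (begin
    + length φ                    ≡⟨ weight-act-elementary φ φ-elementary ⟨
    weight (act φ (λ _ → + 0))    ≡⟨ sumℤ-cong (λ k → cong (+ toℕ k ℤ.*_) (φ≈ψ (λ _ → + 0) k)) ⟩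
    weight (act ψ (λ _ → + 0))    ≡⟨ weight-act-elementary ψ ψ-elementary ⟩
    + length ψ                    ∎))
  where open ≡-Reasoning

Ω⇒elementary : {α : Tuple n} {φ : RaisingOp n} → Ω α φ → All Elementary φ
Ω⇒elementary Ω-id               = []
Ω⇒elementary (Ω-step o el ω _) = el ∷ Ω⇒elementary ω

-- Carried along Ω because monomial′-factor needs natural exponents.
NatValued : Tuple n → Set
NatValued κ = ∀ k → Σ ℕ λ m → κ k ≡ + m

Ω-straightening : (lam : Fin n → ℕ) {φ : RaisingOp n} → Ω (toTuple (λ a → lam a + ρ n a)) φ →
  NatValued (act φ (toTuple lam)) ×
  (∀ x t → P (act φ (toTuple lam)) x t ≡ powℕ t (length φ) * P (toTuple lam) x t)
Ω-straightening lam Ω-id = (λ k → lam k , refl) , λ x t → sym (ℚP.*-identityˡ _)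
Ω-straightening lam (Ω-step {φ} o elementary ω gap) with Ω-straightening lam ω
... | μ-natural , P-μ = μ′-natural , P-μ′
  where
  open ≡-Reasoning
  p = elementary⇒adjacent elementary
  μ = act φ (toTuple lam)

  descent : μ (i o) ≡ ℤ.suc (μ (j o))
  descent = Ω-descent lam φ o p gap

  swapped : applyOp o μ ≗ μ ∘ swap p
  swapped = applyOp-adjacent o p {μ} descent

  μ′-natural : NatValued (applyOp o μ)
  μ′-natural k with μ-natural (swap p k)
  ... | m , μₖ = m , trans (swapped k) μₖ

  P-μ′ : ∀ x t → P (applyOp o μ) x t ≡ powℕ t (suc (length φ)) * P (toTuple lam) x t
  P-μ′ x t with μ-natural (j o)
  ... | c , μⱼ = begin
    P (applyOp o μ) x t
      ≡⟨ P-swap p {μ} swapped (trans descent (cong ℤ.suc μⱼ)) μⱼ x t ⟩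
    t * P μ x t
      ≡⟨ cong (t *_) (P-μ x t) ⟩
    t * (powℕ t (length φ) * P (toTuple lam) x t)
      ≡⟨ ℚP.*-assoc t _ _ ⟨
    powℕ t (suc (length φ)) * P (toTuple lam) x t ∎

mainTheorem3 : (n : ℕ) (lam : Fin n → ℕ) → WeaklyDecreasing lam →
    (φ : RaisingOp n) → Ω (λ k → toTuple (λ a → lam a + ρ n a) k) φ →
    Σ ℕ λ ℓ → IsLength φ ℓ ×
      ((x : Fin n → ℚ) → (∀ a b → a ≢ b → x a ≢ x b) → (∀ a → x a ≢ 0ℚ) →
       (t : ℚ) → P (act φ (toTuple lam)) x t ≡ powℕ t ℓ * P (toTuple lam) x t)
mainTheorem3 n lam _ φ ω =
  length φ ,
  elementary-IsLength φ (Ω⇒elementary ω) ,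
  λ x _ _ t → proj₂ (Ω-straightening lam ω) x t
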